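{- Let $w\in S_\infty$ and let $a,b$ be positive integers with $|a-b|=1$. If there is a reduced word $s_{i_1}\cdots s_{i_k}$ of $w$ such that every index $p$ with $i_p=a$ is smaller than every index $q$ with $i_q=b$ (all occurrences of $s_a$ come before all occurrences of $s_b$), then the same holds for every reduced word of $w$.
   Context: $S_\infty=\bigcup_{m\ge1}S_m$; $s_i$ is the simple transposition swapping $i,i+1$; a reduced word of $w$ is an expression of $w$ as a product of the minimal possible number $\ell(w)$ of simple transpositions. -}

module Defs where

open import Data.Nat using (ℕ; zero; suc; _≤_; _<_; _≟_)
open import Data.List using (List; []; _∷_; length; lookup)
open import Data.List.Relation.Unary.All using (All)
open import Data.Fin as Fin using (Fin)
open import Data.Product using (_×_; ∃)
open import Relation.Binary.PropositionalEquality using (_≡_)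
open import Relation.Nullary using (yes; no)

-- Permutations act on ℕ; the positive integers 1,2,3,... are the points
-- permuted by S_∞ (0 is an extra point fixed by every simple transposition).

s : ℕ → ℕ → ℕ
s i n with n ≟ i
... | yes _ = suc i
... | no _ with n ≟ suc i
...   | yes _ = i
...   | no _ = n

evalWord : List ℕ → ℕ → ℕ
evalWord [] n = n
evalWord (i ∷ is) n = s i (evalWord is n)

InS∞ : (ℕ → ℕ) → Set
InS∞ w = (w 0 ≡ 0)
       × (∀ m n → w m ≡ w n → m ≡ n)
       × (∀ m → ∃ λ n → w n ≡ m)
       × ∃ (λ N → ∀ n → N ≤ n → w n ≡ n)

IsWordOf : List ℕ → (ℕ → ℕ) → Set
IsWordOf u w = All (1 ≤_) u × (∀ n → evalWord u n ≡ w n)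

IsReducedWordOf : List ℕ → (ℕ → ℕ) → Set
IsReducedWordOf u w = IsWordOf u w × (∀ v → IsWordOf v w → length u ≤ length v)

AllBefore : ℕ → ℕ → List ℕ → Set
AllBefore a b u = ∀ (p q : Fin (length u)) → lookup u p ≡ a → lookup u q ≡ b → p Fin.< q

-- Let b = a + 1; the case a = b + 1 follows by passing to w⁻¹, whose reduced words are the
-- reverses of those of w. All s_a precede all s_b in a word exactly when it splits as u₁ u₂
-- with s_b ∉ u₁ and s_a ∉ u₂; then u₂ maps {0,…,a} into itself and u₁ maps {0,…,b} into
-- itself, so w maps {0,…,a} into {0,…,b}, a condition on w alone. Conversely, cut a reduced
-- word of such a w before its first s_b, as u₁ s_b v′. Reducedness of s_b v′ forces
-- v′⁻¹(b) < v′⁻¹(b+1), which makes v′ map {0,…,a} into itself. A reduced word of a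
-- permutation stabilising {0,…,a} cannot contain s_a: at its first occurrence, s_a v″, the
-- same inequality v″⁻¹(a) < v″⁻¹(a+1) together with pigeonhole yields a point of {0,…,a}
-- sent to a+1.
module Submission where

open import Defs
open import Data.Nat using (ℕ; suc; _≤_; _<_; _≟_; _≤?_; z≤n; s≤s; s<s⁻¹)
open import Data.Nat.Properties
  using (≤-pred; ≤-refl; ≤-trans; n≤1+n; <⇒≤; <-≤-trans; <-trans; <-asym; <-irrefl; ≮⇒≥; ≤∧≢⇒<;
         1+n≢n; 1+n≰n; n≮0)
open import Data.List using (List; []; _∷_; [_]; _++_; _∷ʳ_; reverse; length)
open import Data.List.Properties using (unfold-reverse; reverse-++; reverse-involutive; length-reverse)
open import Data.List.Relation.Unary.All as All using (All; []; _∷_)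
open import Data.List.Relation.Unary.Any using (index)
open import Data.List.Relation.Unary.Any.Properties using (lookup-index; reverse⁻)
open import Data.List.Membership.Propositional using (_∈_)
open import Data.List.Membership.Propositional.Properties using (∈-lookup)
open import Data.Fin as Fin using (Fin; toℕ; fromℕ<)
open import Data.Fin.Properties using (injective⇒≤; toℕ-injective; toℕ-fromℕ<; toℕ<n)
open import Data.Product using (Σ; _×_; _,_; ∃; ∃₂)
open import Data.Sum using (_⊎_; inj₁; inj₂)
open import Data.Empty using (⊥-elim)
open import Function using (_∘_)
open import Relation.Nullary using (¬_; yes; no; contradiction)
open import Relation.Nullary.Decidable using (_×-dec_)
open import Relation.Binary.PropositionalEquality using (_≡_; _≢_; refl; sym; trans; cong; subst; subst₂; module ≡-Reasoning)
open ≡-Reasoning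

transpose : ℕ → ℕ → ℕ → ℕ
transpose x y z with z ≟ x
... | yes _ = y
... | no _ with z ≟ y
...   | yes _ = x
...   | no _ = z

data Position (x y z : ℕ) : Set where
  at-x      : z ≡ x → Position x y z
  at-y      : z ≢ x → z ≡ y → Position x y z
  elsewhere : z ≢ x → z ≢ y → Position x y z

position : ∀ x y z → Position x y z
position x y z with z ≟ x
... | yes z≡x = at-x z≡x
... | no z≢x with z ≟ y
...   | yes z≡y = at-y z≢x z≡y
...   | no z≢y = elsewhere z≢x z≢y

transpose-x : ∀ x y → transpose x y x ≡ y
transpose-x x y with x ≟ x
... | yes _ = refl
... | no x≢x = contradiction refl x≢x

transpose-y : ∀ {x y} → y ≢ x → transpose x y y ≡ x
transpose-y {x} {y} y≢x with y ≟ x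
... | yes y≡x = contradiction y≡x y≢x
... | no _ with y ≟ y
...   | yes _ = refl
...   | no y≢y = contradiction refl y≢y

transpose-elsewhere : ∀ {x y z} → z ≢ x → z ≢ y → transpose x y z ≡ z
transpose-elsewhere {x} {y} {z} z≢x z≢y with z ≟ x
... | yes z≡x = contradiction z≡x z≢x
... | no _ with z ≟ y
...   | yes z≡y = contradiction z≡y z≢y
...   | no _ = refl

involution-conjugates-transpose : ∀ {f : ℕ → ℕ} → (∀ z → f (f z) ≡ z) →
  ∀ x y z → f (transpose (f x) (f y) z) ≡ transpose x y (f z)
involution-conjugates-transpose {f} invol x y z with position (f x) (f y) z
... | at-x refl = begin
  f (transpose (f x) (f y) (f x))  ≡⟨ cong f (transpose-x (f x) (f y)) ⟩
  f (f y)                          ≡⟨ invol y ⟩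
  y                                ≡⟨ transpose-x x y ⟨
  transpose x y x                  ≡⟨ cong (transpose x y) (invol x) ⟨
  transpose x y (f (f x))          ∎
... | at-y fy≢fx refl = begin
  f (transpose (f x) (f y) (f y))  ≡⟨ cong f (transpose-y fy≢fx) ⟩
  f (f x)                          ≡⟨ invol x ⟩
  x                                ≡⟨ transpose-y (fy≢fx ∘ cong f) ⟨
  transpose x y y                  ≡⟨ cong (transpose x y) (invol y) ⟨
  transpose x y (f (f y))          ∎
... | elsewhere z≢fx z≢fy = begin
  f (transpose (f x) (f y) z)  ≡⟨ cong f (transpose-elsewhere z≢fx z≢fy) ⟩
  f z                          ≡⟨ transpose-elsewhere (z≢fx ∘ moved) (z≢fy ∘ moved) ⟨
  transpose x y (f z)          ∎
  where
  moved : ∀ {t} → f z ≡ t → z ≡ f t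
  moved refl = sym (invol z)

s≗transpose : ∀ i n → s i n ≡ transpose i (suc i) n
s≗transpose i n with n ≟ i
... | yes _ = refl
... | no _ with n ≟ suc i
...   | yes _ = refl
...   | no _ = refl

s-i : ∀ i → s i i ≡ suc i
s-i i = trans (s≗transpose i i) (transpose-x i (suc i))

s-suc-i : ∀ i → s i (suc i) ≡ i
s-suc-i i = trans (s≗transpose i (suc i)) (transpose-y 1+n≢n)

s-elsewhere : ∀ {i n} → n ≢ i → n ≢ suc i → s i n ≡ n
s-elsewhere {i} {n} n≢i n≢1+i = trans (s≗transpose i n) (transpose-elsewhere n≢i n≢1+i)

s-involutive : ∀ i n → s i (s i n) ≡ n
s-involutive i n with position i (suc i) n
... | at-x refl = trans (cong (s i) (s-i i)) (s-suc-i i)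
... | at-y _ refl = trans (cong (s i) (s-suc-i i)) (s-i i)
... | elsewhere n≢i n≢1+i = trans (cong (s i) (s-elsewhere n≢i n≢1+i)) (s-elsewhere n≢i n≢1+i)

s-moveˡ : ∀ {i a b} → s i a ≡ b → a ≡ s i b
s-moveˡ {i} {a} refl = sym (s-involutive i a)

s-preserves-≤ : ∀ {i m z} → i ≢ m → z ≤ m → s i z ≤ m
s-preserves-≤ {i} {m} {z} i≢m z≤m with position i (suc i) z
... | at-x refl = subst (_≤ m) (sym (s-i i)) (≤∧≢⇒< z≤m i≢m)
... | at-y _ refl = subst (_≤ m) (sym (s-suc-i i)) (≤-trans (n≤1+n i) z≤m)
... | elsewhere z≢i z≢1+i = subst (_≤ m) (sym (s-elsewhere z≢i z≢1+i)) z≤m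

s-reflects-≤ : ∀ {i m z} → i ≢ m → s i z ≤ m → z ≤ m
s-reflects-≤ {i} {m} {z} i≢m sz≤m = subst (_≤ m) (s-involutive i z) (s-preserves-≤ i≢m sz≤m)

s-≤-i : ∀ {i y} → s i y ≤ i → y ≢ suc i → y < i
s-≤-i {i} {y} sy≤i y≢1+i with position i (suc i) y
... | at-x refl = contradiction (subst (_≤ i) (s-i i) sy≤i) 1+n≰n
... | at-y _ y≡1+i = contradiction y≡1+i y≢1+i
... | elsewhere y≢i y≢1+i = ≤∧≢⇒< (subst (_≤ i) (s-elsewhere y≢i y≢1+i) sy≤i) y≢i

s-monotone : ∀ {i x y} → x < y → ¬ (x ≡ i × y ≡ suc i) → s i x < s i y
s-monotone {i} {x} {y} x<y not-pair with position i (suc i) x | position i (suc i) y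
... | at-x refl      | at-x refl      = ⊥-elim (<-irrefl refl x<y)
... | at-x refl      | at-y _ refl    = contradiction (refl , refl) not-pair
... | at-x refl      | elsewhere c d  rewrite s-i i | s-elsewhere c d = ≤∧≢⇒< x<y (d ∘ sym)
... | at-y _ refl    | at-x refl      = ⊥-elim (<-irrefl refl (<-trans x<y ≤-refl))
... | at-y _ refl    | at-y _ refl    = ⊥-elim (<-irrefl refl x<y)
... | at-y _ refl    | elsewhere c d  rewrite s-suc-i i | s-elsewhere c d = <-trans ≤-refl x<y
... | elsewhere a b  | at-x refl      rewrite s-elsewhere a b | s-i i = <-trans x<y ≤-refl
... | elsewhere a b  | at-y _ refl    rewrite s-elsewhere a b | s-suc-i i = ≤∧≢⇒< (≤-pred x<y) a
... | elsewhere a b  | elsewhere c d  rewrite s-elsewhere a b | s-elsewhere c d = x<y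

evalWord-++ : ∀ u v n → evalWord (u ++ v) n ≡ evalWord u (evalWord v n)
evalWord-++ [] v n = refl
evalWord-++ (i ∷ u) v n = cong (s i) (evalWord-++ u v n)

evalWord-reverse-inverseˡ : ∀ v n → evalWord (reverse v) (evalWord v n) ≡ n
evalWord-reverse-inverseˡ [] n = refl
evalWord-reverse-inverseˡ (i ∷ v) n = begin
  evalWord (reverse (i ∷ v)) (s i (evalWord v n))  ≡⟨ cong (λ r → evalWord r (s i (evalWord v n))) (unfold-reverse i v) ⟩
  evalWord (reverse v ∷ʳ i) (s i (evalWord v n))   ≡⟨ evalWord-++ (reverse v) [ i ] (s i (evalWord v n)) ⟩
  evalWord (reverse v) (s i (s i (evalWord v n)))  ≡⟨ cong (evalWord (reverse v)) (s-involutive i (evalWord v n)) ⟩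
  evalWord (reverse v) (evalWord v n)              ≡⟨ evalWord-reverse-inverseˡ v n ⟩
  n                                                ∎

evalWord-reverse-inverseʳ : ∀ v n → evalWord v (evalWord (reverse v) n) ≡ n
evalWord-reverse-inverseʳ v n =
  subst (λ r → evalWord r (evalWord (reverse v) n) ≡ n) (reverse-involutive v)
        (evalWord-reverse-inverseˡ (reverse v) n)

evalWord-injective : ∀ v {x y} → evalWord v x ≡ evalWord v y → x ≡ y
evalWord-injective v {x} {y} e = begin
  x                                    ≡⟨ evalWord-reverse-inverseˡ v x ⟨
  evalWord (reverse v) (evalWord v x)  ≡⟨ cong (evalWord (reverse v)) e ⟩
  evalWord (reverse v) (evalWord v y)  ≡⟨ evalWord-reverse-inverseˡ v y ⟩
  y                                    ∎

evalWord-reverse-cong : ∀ {u v} → (∀ n → evalWord u n ≡ evalWord v n) →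
  ∀ n → evalWord (reverse u) n ≡ evalWord (reverse v) n
evalWord-reverse-cong {u} {v} u≗v n = begin
  evalWord (reverse u) n                                  ≡⟨ cong (evalWord (reverse u)) (evalWord-reverse-inverseʳ v n) ⟨
  evalWord (reverse u) (evalWord v (evalWord (reverse v) n)) ≡⟨ cong (evalWord (reverse u)) (u≗v _) ⟨
  evalWord (reverse u) (evalWord u (evalWord (reverse v) n)) ≡⟨ evalWord-reverse-inverseˡ u _ ⟩
  evalWord (reverse v) n                                  ∎

all-reverse : ∀ {P : ℕ → Set} {xs} → All P xs → All P (reverse xs)
all-reverse pxs = All.tabulate (All.lookup pxs ∘ reverse⁻)

-- Strong exchange property: the transposition is pushed through the leading letters by
-- conjugation until it meets a letter equal to it, which it cancels.
exchange : ∀ v {x y p q} → All (1 ≤_) v → x < y → q < p → evalWord v p ≡ x → evalWord v q ≡ y →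
  ∃ λ u → All (1 ≤_) u × suc (length u) ≡ length v × (∀ n → evalWord u n ≡ transpose x y (evalWord v n))
exchange [] [] x<y q<p refl refl = ⊥-elim (<-asym x<y q<p)
exchange (j ∷ v) {x} {y} (j≥1 ∷ v≥1) x<y q<p vp≡x vq≡y with (x ≟ j) ×-dec (y ≟ suc j)
... | yes (refl , refl) = v , v≥1 , refl , λ n → begin
  evalWord v n                              ≡⟨ s-involutive x (evalWord v n) ⟨
  s x (s x (evalWord v n))                  ≡⟨ s≗transpose x (s x (evalWord v n)) ⟩
  transpose x (suc x) (s x (evalWord v n))  ∎
... | no not-pair with exchange v v≥1 (s-monotone x<y not-pair) q<p (s-moveˡ vp≡x) (s-moveˡ vq≡y)
...   | u , u≥1 , length-u , u≗ = j ∷ u , j≥1 ∷ u≥1 , cong suc length-u , λ n → begin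
  s j (evalWord u n)                                 ≡⟨ cong (s j) (u≗ n) ⟩
  s j (transpose (s j x) (s j y) (evalWord v n))     ≡⟨ involution-conjugates-transpose {s j} (s-involutive j) x y (evalWord v n) ⟩
  transpose x y (s j (evalWord v n))                 ∎

Reduced : List ℕ → Set
Reduced v = IsReducedWordOf v (evalWord v)

reducedWordOf⇒reduced : ∀ {v w} → IsReducedWordOf v w → Reduced v
reducedWordOf⇒reduced ((v≥1 , v≗w) , minimal) =
  (v≥1 , λ _ → refl) , λ u (u≥1 , u≗v) → minimal u (u≥1 , λ n → trans (u≗v n) (v≗w n))

reduced-tail : ∀ {i is} → Reduced (i ∷ is) → Reduced is
reduced-tail {i} ((i≥1 ∷ is≥1 , _) , minimal) =
  (is≥1 , λ _ → refl) , λ u (u≥1 , u≗is) → ≤-pred (minimal (i ∷ u) (i≥1 ∷ u≥1 , cong (s i) ∘ u≗is))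

reduced-reverse : ∀ {v} → Reduced v → Reduced (reverse v)
reduced-reverse {v} ((v≥1 , _) , minimal) = (all-reverse v≥1 , λ _ → refl) , shortest
  where
  shortest : ∀ u → IsWordOf u (evalWord (reverse v)) → length (reverse v) ≤ length u
  shortest u (u≥1 , u≗v′) = subst₂ _≤_ (sym (length-reverse v)) (length-reverse u)
    (minimal (reverse u) (all-reverse u≥1 , λ n →
      subst (λ r → evalWord (reverse u) n ≡ evalWord r n) (reverse-involutive v) (evalWord-reverse-cong {u} {reverse v} u≗v′ n)))

-- A descent would let exchange shorten the word s_i v by two letters.
reduced-no-descent : ∀ {i is p q} → Reduced (i ∷ is) → evalWord is p ≡ i → evalWord is q ≡ suc i → ¬ q < p
reduced-no-descent {i} {is} ((_ ∷ is≥1 , _) , minimal) isp≡i isq≡1+i q<p =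
  let u , u≥1 , length-u , u≗ = exchange is is≥1 ≤-refl q<p isp≡i isq≡1+i
      u-word : IsWordOf u (evalWord (i ∷ is))
      u-word = u≥1 , λ n → trans (u≗ n) (sym (s≗transpose i (evalWord is n)))
  in 1+n≰n (≤-trans (minimal u u-word) (subst (length u ≤_) length-u (n≤1+n (length u))))

reduced-ascent : ∀ {i is p q} → Reduced (i ∷ is) → evalWord is p ≡ i → evalWord is q ≡ suc i → p < q
reduced-ascent r isp≡i isq≡1+i =
  ≤∧≢⇒< (≮⇒≥ (reduced-no-descent r isp≡i isq≡1+i)) λ { refl → 1+n≢n (trans (sym isq≡1+i) isp≡i) }

Maps≤ : ℕ → ℕ → (ℕ → ℕ) → Set
Maps≤ m n f = ∀ {x} → x ≤ m → f x ≤ n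

-- Pigeonhole: otherwise f would inject the m + 2 points {0,…,m} ∪ {y} into {0,…,m}.
injection-reflects-≤ : ∀ {m} {f : ℕ → ℕ} → (∀ {x y} → f x ≡ f y → x ≡ y) → Maps≤ m m f →
  ∀ {y} → f y ≤ m → y ≤ m
injection-reflects-≤ {m} {f} f-injective f-maps≤ {y} fy≤m with y ≤? m
... | yes y≤m = y≤m
... | no y≰m = ⊥-elim (1+n≰n (injective⇒≤ g-injective))
  where
  e : Fin (suc (suc m)) → ℕ
  e Fin.zero = y
  e (Fin.suc i) = toℕ i

  fe≤m : ∀ i → f (e i) ≤ m
  fe≤m Fin.zero = fy≤m
  fe≤m (Fin.suc i) = f-maps≤ (≤-pred (toℕ<n i))

  g : Fin (suc (suc m)) → Fin (suc m)
  g i = fromℕ< (s≤s (fe≤m i))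

  y≢toℕ : ∀ i → y ≢ toℕ i
  y≢toℕ i refl = y≰m (≤-pred (toℕ<n i))

  e-injective : ∀ {i j} → e i ≡ e j → i ≡ j
  e-injective {Fin.zero} {Fin.zero} _ = refl
  e-injective {Fin.zero} {Fin.suc j} y≡j = contradiction y≡j (y≢toℕ j)
  e-injective {Fin.suc i} {Fin.zero} i≡y = contradiction (sym i≡y) (y≢toℕ i)
  e-injective {Fin.suc i} {Fin.suc j} i≡j = cong Fin.suc (toℕ-injective i≡j)

  g-injective : ∀ {i j} → g i ≡ g j → i ≡ j
  g-injective {i} {j} gi≡gj = e-injective (f-injective (begin
    f (e i)        ≡⟨ toℕ-fromℕ< (s≤s (fe≤m i)) ⟨
    toℕ (g i)      ≡⟨ cong toℕ gi≡gj ⟩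
    toℕ (g j)      ≡⟨ toℕ-fromℕ< (s≤s (fe≤m j)) ⟩
    f (e j)        ∎))

avoiding-maps≤ : ∀ {m} v → All (_≢ m) v → Maps≤ m m (evalWord v)
avoiding-maps≤ [] [] x≤m = x≤m
avoiding-maps≤ (i ∷ v) (i≢m ∷ v-avoids) x≤m = s-preserves-≤ i≢m (avoiding-maps≤ v v-avoids x≤m)

reduced-∷-not-stable : ∀ {i is} → Reduced (i ∷ is) → ¬ Maps≤ i i (evalWord (i ∷ is))
reduced-∷-not-stable {i} {is} r stable = 1+n≰n (subst (_≤ i) vp≡1+i (stable p≤i))
  where
  p q : ℕ
  p = evalWord (reverse is) i
  q = evalWord (reverse is) (suc i)
  isp≡i : evalWord is p ≡ i
  isp≡i = evalWord-reverse-inverseʳ is i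
  isq≡1+i : evalWord is q ≡ suc i
  isq≡1+i = evalWord-reverse-inverseʳ is (suc i)
  vp≡1+i : evalWord (i ∷ is) p ≡ suc i
  vp≡1+i = trans (cong (s i) isp≡i) (s-i i)
  vq≡i : evalWord (i ∷ is) q ≡ i
  vq≡i = trans (cong (s i) isq≡1+i) (s-suc-i i)
  q≤i : q ≤ i
  q≤i = injection-reflects-≤ (evalWord-injective (i ∷ is)) stable (subst (_≤ i) (sym vq≡i) ≤-refl)
  p≤i : p ≤ i
  p≤i = <⇒≤ (<-≤-trans (reduced-ascent r isp≡i isq≡1+i) q≤i)

reduced-stable-avoids : ∀ {m} v → Reduced v → Maps≤ m m (evalWord v) → All (_≢ m) v
reduced-stable-avoids [] _ _ = []
reduced-stable-avoids {m} (i ∷ is) r stable with i ≟ m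
... | yes refl = ⊥-elim (reduced-∷-not-stable r stable)
... | no i≢m = i≢m ∷ reduced-stable-avoids is (reduced-tail r) (s-reflects-≤ i≢m ∘ stable)

-- If s_{c+1} v′ is reduced, v′⁻¹(c+1) < v′⁻¹(c+2), so v′ cannot send a point of {0,…,c} to
-- c+2 without s_{c+1} v′ sending an even smaller point to c+2.
reduced-∷-suc-maps≤ : ∀ {c is} → Reduced (suc c ∷ is) → Maps≤ c (suc c) (evalWord (suc c ∷ is)) →
  Maps≤ c c (evalWord is)
reduced-∷-suc-maps≤ {c} {is} r maps≤ {x} x≤c with evalWord is x ≟ suc (suc c)
... | yes isx≡2+c = ⊥-elim (1+n≰n (subst (_≤ suc c) vp≡2+c (maps≤ p≤c)))
  where
  p : ℕ
  p = evalWord (reverse is) (suc c)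
  isp≡1+c : evalWord is p ≡ suc c
  isp≡1+c = evalWord-reverse-inverseʳ is (suc c)
  vp≡2+c : evalWord (suc c ∷ is) p ≡ suc (suc c)
  vp≡2+c = trans (cong (s (suc c)) isp≡1+c) (s-i (suc c))
  p≤c : p ≤ c
  p≤c = <⇒≤ (<-≤-trans (reduced-ascent r isp≡1+c isx≡2+c) x≤c)
... | no isx≢2+c = ≤-pred (s-≤-i (maps≤ x≤c) isx≢2+c)

Separated : ℕ → ℕ → List ℕ → Set
Separated a b u = ∃₂ λ u₁ u₂ → u ≡ u₁ ++ u₂ × All (_≢ b) u₁ × All (_≢ a) u₂

separated-reverse : ∀ {a b u} → Separated a b u → Separated b a (reverse u)
separated-reverse (u₁ , u₂ , refl , u₁-avoids , u₂-avoids) =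
  reverse u₂ , reverse u₁ , reverse-++ u₁ u₂ , all-reverse u₂-avoids , all-reverse u₁-avoids

separated-maps≤ : ∀ {c u} → Separated c (suc c) u → Maps≤ c (suc c) (evalWord u)
separated-maps≤ {c} (u₁ , u₂ , refl , u₁-avoids , u₂-avoids) {x} x≤c =
  subst (_≤ suc c) (sym (evalWord-++ u₁ u₂ x))
    (avoiding-maps≤ u₁ u₁-avoids (≤-trans (avoiding-maps≤ u₂ u₂-avoids x≤c) (n≤1+n c)))

reduced-maps≤-separated : ∀ {c} v → Reduced v → Maps≤ c (suc c) (evalWord v) → Separated c (suc c) v
reduced-maps≤-separated [] _ _ = [] , [] , refl , [] , []
reduced-maps≤-separated {c} (i ∷ is) r maps≤ with i ≟ suc c
... | yes refl = [] , i ∷ is , refl , [] ,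
  1+n≢n ∷ reduced-stable-avoids is (reduced-tail r) (reduced-∷-suc-maps≤ r maps≤)
... | no i≢1+c with reduced-maps≤-separated is (reduced-tail r) (s-reflects-≤ i≢1+c ∘ maps≤)
...   | u₁ , u₂ , refl , u₁-avoids , u₂-avoids = i ∷ u₁ , u₂ , refl , i≢1+c ∷ u₁-avoids , u₂-avoids

separated-ascending-invariant : ∀ {c u v} → (∀ n → evalWord u n ≡ evalWord v n) → Reduced v →
  Separated c (suc c) u → Separated c (suc c) v
separated-ascending-invariant {c} {v = v} u≗v r sep =
  reduced-maps≤-separated v r λ x≤c → subst (_≤ suc c) (u≗v _) (separated-maps≤ sep x≤c)

separated-descending-invariant : ∀ {c u v} → (∀ n → evalWord u n ≡ evalWord v n) → Reduced v →
  Separated (suc c) c u → Separated (suc c) c v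
separated-descending-invariant {c} {u} {v} u≗v r sep =
  subst (Separated (suc c) c) (reverse-involutive v)
    (separated-reverse (separated-ascending-invariant (evalWord-reverse-cong {u} {v} u≗v) (reduced-reverse r)
      (separated-reverse sep)))

separated⇒allBefore : ∀ {a b u} → Separated a b u → AllBefore a b u
separated⇒allBefore {a} {b} (u₁ , u₂ , refl , u₁-avoids , u₂-avoids) = avoiding-++ u₁ u₁-avoids
  where
  avoiding-++ : ∀ u₁ → All (_≢ b) u₁ → AllBefore a b (u₁ ++ u₂)
  avoiding-++ [] _ p _ up≡a _ = contradiction up≡a (All.lookup u₂-avoids (∈-lookup p))
  avoiding-++ (i ∷ u₁) (i≢b ∷ _) _ Fin.zero _ i≡b = contradiction i≡b i≢b
  avoiding-++ (i ∷ u₁) _ Fin.zero (Fin.suc q) _ _ = s≤s z≤n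
  avoiding-++ (i ∷ u₁) (_ ∷ u₁-avoids) (Fin.suc p) (Fin.suc q) up≡a uq≡b =
    s≤s (avoiding-++ u₁ u₁-avoids p q up≡a uq≡b)

allBefore⇒separated : ∀ {a b} → a ≢ b → ∀ u → AllBefore a b u → Separated a b u
allBefore⇒separated a≢b [] _ = [] , [] , refl , [] , []
allBefore⇒separated {a} {b} a≢b (i ∷ is) before with i ≟ b
... | yes refl = [] , i ∷ is , refl , [] , (a≢b ∘ sym) ∷ All.tabulate no-a-after-b
  where
  no-a-after-b : ∀ {x} → x ∈ is → x ≢ a
  no-a-after-b x∈is x≡a = n≮0 (before (Fin.suc (index x∈is)) Fin.zero (trans (sym (lookup-index x∈is)) x≡a) refl)
... | no i≢b with allBefore⇒separated a≢b is (λ p q is-p≡a is-q≡b → s<s⁻¹ (before (Fin.suc p) (Fin.suc q) is-p≡a is-q≡b))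
...   | u₁ , u₂ , refl , u₁-avoids , u₂-avoids = i ∷ u₁ , u₂ , refl , i≢b ∷ u₁-avoids , u₂-avoids

lemma2p3 : (w : ℕ → ℕ) → InS∞ w → (a b : ℕ) → 1 ≤ a → 1 ≤ b → (b ≡ suc a ⊎ a ≡ suc b)
    → Σ (List ℕ) (λ u → IsReducedWordOf u w × AllBefore a b u)
    → (v : List ℕ) → IsReducedWordOf v w → AllBefore a b v
lemma2p3 w _ a b _ _ adjacent (u , ((_ , u≗w) , _) , u-before) v v-reduced@((_ , v≗w) , _) =
  separated⇒allBefore (invariant adjacent)
  where
  u≗v : ∀ n → evalWord u n ≡ evalWord v n
  u≗v n = trans (u≗w n) (sym (v≗w n))

  invariant : (b ≡ suc a ⊎ a ≡ suc b) → Separated a b v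
  invariant (inj₁ refl) = separated-ascending-invariant u≗v (reducedWordOf⇒reduced v-reduced)
    (allBefore⇒separated (1+n≢n ∘ sym) u u-before)
  invariant (inj₂ refl) = separated-descending-invariant u≗v (reducedWordOf⇒reduced v-reduced)
    (allBefore⇒separated 1+n≢n u u-before)
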